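{- For all positive integers $q$ and $r$, with $n=r(q-1)+1$, the winding permutation $3$--hypergraph $W_{q,r}$ satisfies $\chi(W_{q,r})=\left\lceil \frac{n}{r+1}\right\rceil$.
   Context: A cyclic permutation of $\{1,\dots,n\}$ is a class $[\phi]$ of bijections $\phi:\{1,\dots,n\}\to\{1,\dots,n\}$ modulo cyclic rotation ($\phi\sim\psi$ iff there is $k$ with $\phi(i)=\psi(i+k)$ for all $i$, indices mod $n$). Elements $i<j<k$ are in clockwise order with respect to $[\phi]$ if some $\psi\in[\phi]$ has $\psi^{ -1}(i)<\psi^{ -1}(j)<\psi^{ -1}(k)$. The $3$--hypergraph associated to $[\phi]$ has vertex set $\{1,\dots,n\}$ and edges the triples $\{i,j,k\}$, $i<j<k$, in clockwise order with respect to $[\phi]$. For positive integers $q,r$, let $n=r(q-1)+1$ and define $\phi_{q,r}:\{1,\dots,n\}\to\{1,\dots,n\}$ by $\phi_{q,r}(n)=1$ and, for $1\le i<n$ with $i\equiv j \pmod r$, $1\le j\le r$, $\phi_{q,r}(i)=2+(q-1)(r-j)+\frac{i-j}{r}$. $W_{q,r}$ is the $3$--hypergraph associated to $[\phi_{q,r}]$ (e.g. for $q=5,r=3$ the permutation is $(10\,6\,2\,11\,7\,3\,12\,8\,4\,13\,9\,5\,1)$). The chromatic number $\chi(H)$ of a $3$--hypergraph is the minimum number of classes in a partition of its vertex set with no edge contained in a single class. -}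

module Defs where

open import Data.Nat using (ℕ; zero; suc; _≡ᵇ_; _+_; _*_; _∸_; _≤_; _<_; NonZero)
open import Data.Nat.DivMod using (_/_; _%_)
open import Data.Fin using (Fin)
open import Data.Bool using (if_then_else_)
open import Data.Product using (Σ; _×_; ∃-syntax)
open import Relation.Binary.PropositionalEquality using (_≡_)
open import Relation.Nullary using (¬_)

-- A "permutation" of {1,…,n} is represented by a function ℕ → ℕ,
-- of which only the values on 1..n matter.

rotPos : (n s a : ℕ) → .{{_ : NonZero n}} → ℕ
rotPos n s a = (a + s) % n

-- i, j, k are in clockwise order w.r.t. the cyclic class [φ]:
-- some rotation ψ of φ (ψ(x) = φ(x + s), indices mod n) has
-- ψ⁻¹(i) < ψ⁻¹(j) < ψ⁻¹(k).
Clockwise : (n : ℕ) .{{_ : NonZero n}} → (ℕ → ℕ) → ℕ → ℕ → ℕ → Set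
Clockwise n φ i j k =
  ∃[ s ] ∃[ a ] ∃[ b ] ∃[ c ]
    (s < n) × (1 ≤ a × a ≤ n) × (1 ≤ b × b ≤ n) × (1 ≤ c × c ≤ n)
    × (φ a ≡ i) × (φ b ≡ j) × (φ c ≡ k)
    × (rotPos n s a < rotPos n s b) × (rotPos n s b < rotPos n s c)

-- The 3-hypergraph associated to [φ]: vertex set {1..n}, edges {i,j,k}
-- with i < j < k in clockwise order.  An edge is given by its sorted triple.
Edge : (n : ℕ) .{{_ : NonZero n}} → (ℕ → ℕ) → ℕ → ℕ → ℕ → Set
Edge n φ i j k = (1 ≤ i) × (i < j) × (j < k) × (k ≤ n) × Clockwise n φ i j k

ProperColouring : (n : ℕ) .{{_ : NonZero n}} → (ℕ → ℕ) → (m : ℕ) → (ℕ → Fin m) → Set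
ProperColouring n φ m col =
  ∀ i j k → Edge n φ i j k → ¬ (col i ≡ col j × col j ≡ col k)

Colourable : (n : ℕ) .{{_ : NonZero n}} → (ℕ → ℕ) → ℕ → Set
Colourable n φ m = Σ (ℕ → Fin m) (ProperColouring n φ m)

ChromaticNumberIs : (n : ℕ) .{{_ : NonZero n}} → (ℕ → ℕ) → ℕ → Set
ChromaticNumberIs n φ m = Colourable n φ m × (∀ m' → Colourable n φ m' → m ≤ m')

-- n = r(q-1)+1  (written with suc so that NonZero n is found automatically)
wn : ℕ → ℕ → ℕ
wn q r = suc (r * (q ∸ 1))

-- φ_{q,r}(n) = 1 ; for 1 ≤ i < n with i ≡ j (mod r), 1 ≤ j ≤ r:
-- φ_{q,r}(i) = 2 + (q-1)(r-j) + (i-j)/r.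
-- (j = ((i-1) mod r) + 1; r divides i - j, so the division is exact.)
phiW : (q r : ℕ) .{{_ : NonZero r}} → ℕ → ℕ
phiW q r i =
  if i ≡ᵇ wn q r then 1
  else 2 + (q ∸ 1) * (r ∸ jj) + (i ∸ jj) / r
  where
  jj : ℕ
  jj = suc ((i ∸ 1) % r)

ceilDiv : ℕ → (b : ℕ) .{{_ : NonZero b}} → ℕ
ceilDiv a b = (a + (b ∸ 1)) / b

-- Number the positions of the cyclic sequence 0, …, n-1 starting at the value 1 and write
-- p + R = row·r + residue (r = R + 1, q = Q + 1).  The value at p is
-- 1 + Q·(R - residue) + row, so along positions p < p′ the value rises exactly when the residue
-- does not rise, and then the row rises.  Colouring p by ⌊p/(r+1)⌋ is proper: inside a block of
-- r + 1 consecutive positions the rows take at most two consecutive values, and each of the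
-- three cyclic placements of an ascending triple would make the rows both rise and not rise.
-- Conversely, if q < p < p′ have one colour and p, p′ share a residue, then q, p, p′ form an
-- edge (whichever residue q has).  Hence all elements of a colour class except its first have
-- distinct residues, every class has at most r + 1 elements, and n ≤ χ·(r + 1).

module Submission where

open import Data.Nat
open import Data.Nat.Properties
open import Data.Nat.DivMod
open import Data.Nat.Divisibility using (n∣m*n)
open import Data.Bool using (true; false)
open import Data.Product
open import Data.Fin using (Fin; zero; suc; toℕ; fromℕ<; combine)
import Data.Fin.Properties as Fin
open import Data.Fin.Properties using (any?; toℕ<n; toℕ-fromℕ<; toℕ-injective; injective⇒≤; combine-injective)
open import Function.Base using (_∘_)
open import Relation.Nullary.Decidable using (Dec; _×-dec_)
open import Function.Definitions using (Injective)
open import Data.Sum using (_⊎_; inj₁; inj₂; [_,_]′)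
open import Relation.Nullary using (¬_; yes; no; contradiction)
open import Relation.Binary.PropositionalEquality
open import Relation.Binary.Definitions using (tri<; tri≈; tri>)
open import Defs

m<n⇒n%o≤m%o⇒m/o<n/o : ∀ {m n} o .{{_ : NonZero o}} → m < n → n % o ≤ m % o → m / o < n / o
m<n⇒n%o≤m%o⇒m/o<n/o {m} {n} o m<n n%o≤m%o with m / o <? n / o
... | yes lt = lt
... | no ¬lt = contradiction m<n (≤⇒≯ (begin
  n                 ≡⟨ m≡m%n+[m/n]*n n o ⟩
  n % o + n / o * o ≤⟨ +-mono-≤ n%o≤m%o (*-monoˡ-≤ o (≮⇒≥ ¬lt)) ⟩
  m % o + m / o * o ≡⟨ m≡m%n+[m/n]*n m o ⟨
  m                 ∎))
  where open ≤-Reasoning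

n≤m+o⇒m/o<n/o⇒n%o≤m%o : ∀ {m n} o .{{_ : NonZero o}} → n ≤ m + o → m / o < n / o → n % o ≤ m % o
n≤m+o⇒m/o<n/o⇒n%o≤m%o {m} {n} o n≤m+o m/o<n/o = +-cancelʳ-≤ (n / o * o) (n % o) (m % o) (begin
  n % o + n / o * o       ≡⟨ m≡m%n+[m/n]*n n o ⟨
  n                       ≤⟨ n≤m+o ⟩
  m + o                   ≡⟨ cong (_+ o) (m≡m%n+[m/n]*n m o) ⟩
  m % o + m / o * o + o   ≡⟨ +-assoc (m % o) (m / o * o) o ⟩
  m % o + (m / o * o + o) ≡⟨ cong (m % o +_) (+-comm (m / o * o) o) ⟩
  m % o + suc (m / o) * o ≤⟨ +-monoʳ-≤ (m % o) (*-monoˡ-≤ o m/o<n/o) ⟩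
  m % o + n / o * o       ∎)
  where open ≤-Reasoning

m≤n⇒m/o≡n/o⇒n<m+o : ∀ {m n} o .{{_ : NonZero o}} → m ≤ n → m / o ≡ n / o → n < m + o
m≤n⇒m/o≡n/o⇒n<m+o {m} {n} o m≤n eq = begin-strict
  n                 ≡⟨ m≡m%n+[m/n]*n n o ⟩
  n % o + n / o * o <⟨ +-monoˡ-< (n / o * o) (m%n<n n o) ⟩
  o + n / o * o     ≡⟨ cong (λ t → o + t * o) eq ⟨
  o + m / o * o     ≤⟨ +-monoʳ-≤ o (m/n*n≤m m o) ⟩
  o + m             ≡⟨ +-comm o m ⟩
  m + o             ∎
  where open ≤-Reasoning

[m+n]/n≡1+m/n : ∀ m n .{{_ : NonZero n}} → (m + n) / n ≡ suc (m / n)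
[m+n]/n≡1+m/n m n = trans (m/n≡1+[m∸n]/n (m≤n+m n m)) (cong (λ t → suc (t / n)) (m+n∸n≡m m n))

[m∸m%n]/n≡m/n : ∀ m n .{{_ : NonZero n}} → (m ∸ m % n) / n ≡ m / n
[m∸m%n]/n≡m/n m n = begin
  (m ∸ m % n) / n                   ≡⟨ cong (λ t → (t ∸ m % n) / n) (m≡m%n+[m/n]*n m n) ⟩
  (m % n + m / n * n ∸ m % n) / n   ≡⟨ cong (_/ n) (m+n∸m≡n (m % n) (m / n * n)) ⟩
  m / n * n / n                     ≡⟨ m*n/n≡m (m / n) n ⟩
  m / n                             ∎
  where open ≡-Reasoning

m<n⇒m/o<ceilDiv : ∀ {m n} o .{{_ : NonZero o}} → m < n → m / o < ceilDiv n o
m<n⇒m/o<ceilDiv {m} {n} o@(suc d) m<n = begin-strict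
  m / o         <⟨ n<1+n (m / o) ⟩
  suc (m / o)   ≡⟨ [m+n]/n≡1+m/n m o ⟨
  (m + o) / o   ≤⟨ /-monoˡ-≤ o (subst (_≤ n + d) (sym (+-suc m d)) (+-monoˡ-≤ d m<n)) ⟩
  (n + d) / o   ∎
  where open ≤-Reasoning

ceilDiv-least : ∀ {m n} o .{{_ : NonZero o}} → n ≤ m * o → ceilDiv n o ≤ m
ceilDiv-least {m} {n} o@(suc d) n≤m*o = begin
  (n + d) / o         ≤⟨ /-monoˡ-≤ o (+-monoˡ-≤ d n≤m*o) ⟩
  (m * o + d) / o     ≡⟨ cong (_/ o) (+-comm (m * o) d) ⟩
  (d + m * o) / o     ≡⟨ +-distrib-/-∣ʳ d (n∣m*n m) ⟩
  d / o + m * o / o   ≡⟨ cong₂ _+_ (m<n⇒m/n≡0 (n<1+n d)) (m*n/n≡m m o) ⟩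
  m                   ∎
  where open ≤-Reasoning

Cyclic : ℕ → ℕ → ℕ → Set
Cyclic x y z = (x < y × y < z) ⊎ (y < z × z < x) ⊎ (z < x × x < y)

module _ {n : ℕ} .{{_ : NonZero n}} where

  rotPos-%ⁿ : ∀ s a → rotPos n s a ≡ rotPos n s (a % n)
  rotPos-%ⁿ s a = begin
    (a + s) % n                 ≡⟨ %-distribˡ-+ a s n ⟩
    (a % n + s % n) % n         ≡⟨ cong (λ t → (t + s % n) % n) (m%n%n≡m%n a n) ⟨
    (a % n % n + s % n) % n     ≡⟨ %-distribˡ-+ (a % n) s n ⟨
    (a % n + s) % n             ∎
    where open ≡-Reasoning

  rotPos-unwrapped : ∀ s x → x + s < n → rotPos n s x ≡ x + s
  rotPos-unwrapped _ _ = m<n⇒m%n≡m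

  rotPos-wrapped : ∀ {s x} → x < n → s < n → n ≤ x + s → rotPos n s x ≡ x + s ∸ n
  rotPos-wrapped {s} {x} x<n s<n n≤x+s =
    trans (sym (m≤n⇒[n∸m]%m≡n%m n≤x+s))
          (m<n⇒m%n≡m (subst (x + s ∸ n <_) (m+n∸n≡m n n) (∸-monoˡ-< (+-mono-< x<n s<n) n≤x+s)))

  wrapped<shift : ∀ {s x} → x < n → n ≤ x + s → x + s ∸ n < s
  wrapped<shift {s} {x} x<n n≤x+s = subst (x + s ∸ n <_) (m+n∸m≡n n s) (∸-monoˡ-< (+-monoˡ-< s x<n) n≤x+s)

  unwrapped<wrapped : ∀ {s x y} → y + s < n → n ≤ x + s → y < x
  unwrapped<wrapped {s} {x} {y} y+s<n n≤x+s = +-cancelʳ-< s y x (<-≤-trans y+s<n n≤x+s)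

  rotPos-<-cases : ∀ {s x y} → s < n → x < n → y < n → rotPos n s x < rotPos n s y →
                   (n ≤ x + s × y + s < n) ⊎ (x < y × (n ≤ y + s → n ≤ x + s))
  rotPos-<-cases {s} {x} {y} s<n x<n y<n lt with n ≤? x + s | n ≤? y + s
  ... | yes wx | yes wy = inj₂ (+-cancelʳ-< s x y (subst₂ _<_ (m∸n+n≡m wx) (m∸n+n≡m wy) (+-monoˡ-< n
          (subst₂ _<_ (rotPos-wrapped x<n s<n wx) (rotPos-wrapped y<n s<n wy) lt))) , λ _ → wx)
  ... | yes wx | no ¬wy = inj₁ (wx , ≰⇒> ¬wy)
  ... | no ¬wx | yes wy = contradiction lt (<⇒≯ (begin-strict
          rotPos n s y  ≡⟨ rotPos-wrapped y<n s<n wy ⟩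
          y + s ∸ n     <⟨ wrapped<shift y<n wy ⟩
          s             ≤⟨ m≤n+m s x ⟩
          x + s         ≡⟨ rotPos-unwrapped s x (≰⇒> ¬wx) ⟨
          rotPos n s x  ∎))
    where open ≤-Reasoning
  ... | no ¬wx | no ¬wy = inj₂ (+-cancelʳ-< s x y
          (subst₂ _<_ (rotPos-unwrapped s x (≰⇒> ¬wx)) (rotPos-unwrapped s y (≰⇒> ¬wy)) lt) ,
        λ wy → contradiction wy ¬wy)

  rotPos-ascending⇒cyclic : ∀ {s x y z} → s < n → x < n → y < n → z < n →
                            rotPos n s x < rotPos n s y → rotPos n s y < rotPos n s z → Cyclic x y z
  rotPos-ascending⇒cyclic s<n x<n y<n z<n xy yz with rotPos-<-cases s<n x<n y<n xy | rotPos-<-cases s<n y<n z<n yz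
  ... | inj₁ (_ , y+s<n) | inj₁ (n≤y+s , _) = contradiction n≤y+s (<⇒≱ y+s<n)
  ... | inj₁ (n≤x+s , y+s<n) | inj₂ (y<z , wz⇒wy) =
          inj₂ (inj₁ (y<z , unwrapped<wrapped (≰⇒> (λ wz → <⇒≱ y+s<n (wz⇒wy wz))) n≤x+s))
  ... | inj₂ (x<y , wy⇒wx) | inj₁ (n≤y+s , z+s<n) =
          inj₂ (inj₂ (unwrapped<wrapped z+s<n (wy⇒wx n≤y+s) , x<y))
  ... | inj₂ (x<y , _) | inj₂ (y<z , _) = inj₁ (x<y , y<z)

  cyclic⇒rotPos-ascending : ∀ {x y z} → x < n → y < n → z < n → Cyclic x y z →
                            ∃[ s ] s < n × rotPos n s x < rotPos n s y × rotPos n s y < rotPos n s z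
  cyclic⇒rotPos-ascending {x} {y} {z} x<n y<n z<n (inj₁ (x<y , y<z)) =
    0 , n>0 , subst₂ _<_ (sym (unrotated x<n)) (sym (unrotated y<n)) x<y ,
              subst₂ _<_ (sym (unrotated y<n)) (sym (unrotated z<n)) y<z
    where
    n>0 = >-nonZero⁻¹ n
    unrotated : ∀ {t} → t < n → rotPos n 0 t ≡ t
    unrotated {t} t<n = trans (cong (_% n) (+-identityʳ t)) (m<n⇒m%n≡m t<n)
  cyclic⇒rotPos-ascending {x} {y} {z} x<n y<n z<n (inj₂ cyc) = s , s<n , ascending cyc
    where
    s = n ∸ x
    x+s≡n : x + s ≡ n
    x+s≡n = m+[n∸m]≡n (<⇒≤ x<n)
    x>0 : 0 < x
    x>0 = [ (λ (_ , z<x) → ≤-<-trans z≤n z<x) , (λ (z<x , _) → ≤-<-trans z≤n z<x) ]′ cyc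
    s<n : s < n
    s<n = ∸-monoʳ-< x>0 (<⇒≤ x<n)
    s>0 : 0 < s
    s>0 = m<n⇒0<n∸m x<n
    rotPos-x : rotPos n s x ≡ 0
    rotPos-x = trans (cong (_% n) x+s≡n) (n%n≡0 n)
    before : ∀ {t} → t < x → t + s < n
    before {t} t<x = subst (t + s <_) x+s≡n (+-monoˡ-< s t<x)
    ascending : (y < z × z < x) ⊎ (z < x × x < y) → rotPos n s x < rotPos n s y × rotPos n s y < rotPos n s z
    ascending (inj₁ (y<z , z<x)) =
      subst₂ _<_ (sym rotPos-x) (sym rotPos-y) (<-≤-trans s>0 (m≤n+m s y)) ,
      subst₂ _<_ (sym rotPos-y) (sym (rotPos-unwrapped s z (before z<x))) (+-monoˡ-< s y<z)
      where rotPos-y = rotPos-unwrapped s y (before (<-trans y<z z<x))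
    ascending (inj₂ (z<x , x<y)) =
      subst₂ _<_ (sym rotPos-x) (sym rotPos-y) (m<n⇒0<n∸m n<y+s) ,
      subst₂ _<_ (sym rotPos-y) (sym (rotPos-unwrapped s z (before z<x)))
        (<-≤-trans (wrapped<shift y<n (<⇒≤ n<y+s)) (m≤n+m s z))
      where
      n<y+s : n < y + s
      n<y+s = subst (_< y + s) x+s≡n (+-monoˡ-< s x<y)
      rotPos-y = rotPos-wrapped y<n s<n (<⇒≤ n<y+s)

module CyclicSequence (n : ℕ) .{{_ : NonZero n}} (φ val : ℕ → ℕ)
  (φ≡val : ∀ {a} → 1 ≤ a → a ≤ n → φ a ≡ val (a % n))
  (val-range : ∀ {p} → p < n → 1 ≤ val p × val p ≤ n) where

  CyclicAscending : ℕ → ℕ → ℕ → Set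
  CyclicAscending u v w = Cyclic u v w × val u < val v × val v < val w

  Monochromatic : ∀ {m} → (ℕ → Fin m) → ℕ → ℕ → ℕ → Set
  Monochromatic col u v w = col (val u) ≡ col (val v) × col (val v) ≡ col (val w)

  NoMonochromaticTriple : ∀ {m} → (ℕ → Fin m) → Set
  NoMonochromaticTriple col =
    ∀ {u v w} → u < n → v < n → w < n → CyclicAscending u v w → ¬ Monochromatic col u v w

  noMonochromaticTriple⇒proper : ∀ {m} {col : ℕ → Fin m} → NoMonochromaticTriple col → ProperColouring n φ m col
  noMonochromaticTriple⇒proper {col = col} none _ _ _
    (_ , i<j , j<k , _ , s , a , b , c , s<n , (1≤a , a≤n) , (1≤b , b≤n) , (1≤c , c≤n) ,
     refl , refl , refl , ab , bc) (e₁ , e₂) =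
    none (m%n<n a n) (m%n<n b n) (m%n<n c n)
      (rotPos-ascending⇒cyclic s<n (m%n<n a n) (m%n<n b n) (m%n<n c n)
         (subst₂ _<_ (rotPos-%ⁿ s a) (rotPos-%ⁿ s b) ab) (subst₂ _<_ (rotPos-%ⁿ s b) (rotPos-%ⁿ s c) bc) ,
       subst₂ _<_ φa φb i<j , subst₂ _<_ φb φc j<k)
      (subst₂ _≡_ (cong col φa) (cong col φb) e₁ , subst₂ _≡_ (cong col φb) (cong col φc) e₂)
    where
    φa = φ≡val 1≤a a≤n
    φb = φ≡val 1≤b b≤n
    φc = φ≡val 1≤c c≤n

  private
    lift : ℕ → ℕ
    lift zero    = n
    lift (suc u) = suc u

    lift-range : ∀ {u} → u < n → 1 ≤ lift u × lift u ≤ n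
    lift-range {zero}  _   = >-nonZero⁻¹ n , ≤-refl
    lift-range {suc u} u<n = s≤s z≤n , <⇒≤ u<n

    lift-%ⁿ : ∀ {u} → u < n → lift u % n ≡ u
    lift-%ⁿ {zero}  _   = n%n≡0 n
    lift-%ⁿ {suc u} u<n = m<n⇒m%n≡m u<n

    φ-lift : ∀ {u} → u < n → φ (lift u) ≡ val u
    φ-lift u<n = trans (φ≡val (proj₁ (lift-range u<n)) (proj₂ (lift-range u<n))) (cong val (lift-%ⁿ u<n))

    rotPos-lift : ∀ s {u} → u < n → rotPos n s (lift u) ≡ rotPos n s u
    rotPos-lift s {u} u<n = trans (rotPos-%ⁿ s (lift u)) (cong (λ t → rotPos n s t) (lift-%ⁿ u<n))

  proper⇒noMonochromaticTriple : ∀ {m} {col : ℕ → Fin m} → ProperColouring n φ m col → NoMonochromaticTriple col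
  proper⇒noMonochromaticTriple proper {u} {v} {w} u<n v<n w<n (cyc , uv , vw)
    with s , s<n , su<sv , sv<sw ← cyclic⇒rotPos-ascending u<n v<n w<n cyc =
    proper (val u) (val v) (val w)
      (proj₁ (val-range u<n) , uv , vw , proj₂ (val-range w<n) ,
       s , lift u , lift v , lift w , s<n , lift-range u<n , lift-range v<n , lift-range w<n ,
       φ-lift u<n , φ-lift v<n , φ-lift w<n ,
       subst₂ _<_ (sym (rotPos-lift s u<n)) (sym (rotPos-lift s v<n)) su<sv ,
       subst₂ _<_ (sym (rotPos-lift s v<n)) (sym (rotPos-lift s w<n)) sv<sw)

preimage : ∀ {k} → (Fin (suc k) → ℕ) → ℕ → Fin (suc k)
preimage g v with any? (λ i → g i ≟ v)
... | yes (i , _) = i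
... | no _        = zero

preimage-inverse : ∀ {k} {g : Fin (suc k) → ℕ} → Injective _≡_ _≡_ g → ∀ i → preimage g (g i) ≡ i
preimage-inverse {g = g} g-injective i with any? (λ j → g j ≟ g i)
... | yes (j , gj≡gi) = g-injective gj≡gi
... | no ∄j           = contradiction (i , refl) ∄j

module Winding (Q R : ℕ) where

  r n : ℕ
  r = suc R
  n = suc (r * Q)

  φ : ℕ → ℕ
  φ = phiW (suc Q) r

  -- Position p ∈ [0, n) stands for the paper's position p, with position n read as 0.  For
  -- 1 ≤ i < n with i = j + t·r, 1 ≤ j ≤ r, we get i + R = (j - 1) + (t + 1)·r, so the paper's
  -- φ(i) = 2 + (q-1)(r-j) + t is val i; and val 0 = 1 = φ(n).
  row residue val : ℕ → ℕ
  row p = (p + R) / r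
  residue p = (p + R) % r
  val p = suc (Q * (R ∸ residue p) + row p)

  residue≤R : ∀ p → residue p ≤ R
  residue≤R p = ≤-pred (m%n<n (p + R) r)

  val-0 : val 0 ≡ 1
  val-0 rewrite m<n⇒m%n≡m (n<1+n R) | m<n⇒m/n≡0 (n<1+n R) | n∸n≡0 R | *-zeroʳ Q = refl

  φ-last : φ n ≡ 1
  φ-last with r * Q ≡ᵇ r * Q | ≡⇒≡ᵇ (r * Q) (r * Q) refl
  ... | true | _ = refl

  φ-inner : ∀ {x} → x < r * Q → φ (suc x) ≡ val (suc x)
  φ-inner {x} x<rQ with x ≡ᵇ r * Q | ≡ᵇ⇒≡ x (r * Q)
  ... | true  | x≡rQ = contradiction (x≡rQ _) (<⇒≢ x<rQ)
  ... | false | _    = begin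
    2 + Q * (R ∸ x % r) + (x ∸ x % r) / r   ≡⟨ cong (2 + Q * (R ∸ x % r) +_) ([m∸m%n]/n≡m/n x r) ⟩
    2 + Q * (R ∸ x % r) + x / r             ≡⟨ cong suc (+-suc (Q * (R ∸ x % r)) (x / r)) ⟨
    suc (Q * (R ∸ x % r) + suc (x / r))     ≡⟨ cong₂ (λ j t → suc (Q * (R ∸ j) + t)) residue-suc row-suc ⟨
    val (suc x)                             ∎
    where
    open ≡-Reasoning
    residue-suc : residue (suc x) ≡ x % r
    residue-suc = trans (cong (_% r) (sym (+-suc x R))) ([m+n]%n≡m%n x r)
    row-suc : row (suc x) ≡ suc (x / r)
    row-suc = trans (cong (_/ r) (sym (+-suc x R))) ([m+n]/n≡1+m/n x r)

  φ≡val : ∀ {a} → 1 ≤ a → a ≤ n → φ a ≡ val (a % n)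
  φ≡val {suc x} _ a≤n with m≤n⇒m<n∨m≡n (≤-pred a≤n)
  ... | inj₁ x<rQ = trans (φ-inner x<rQ) (cong val (sym (m<n⇒m%n≡m (s≤s x<rQ))))
  ... | inj₂ refl = trans φ-last (trans (sym val-0) (cong val (sym (n%n≡0 n))))

  row<1+Q : ∀ {p} → p < n → row p < suc Q
  row<1+Q {p} p<n = m<n*o⇒m/o<n (begin-strict
    p + R       ≤⟨ +-monoˡ-≤ R (≤-pred p<n) ⟩
    r * Q + R   <⟨ +-monoʳ-< (r * Q) (n<1+n R) ⟩
    r * Q + r   ≡⟨ +-comm (r * Q) r ⟩
    r + r * Q   ≡⟨ cong (r +_) (*-comm r Q) ⟩
    suc Q * r   ∎)
    where open ≤-Reasoning

  val-range : ∀ {p} → p < n → 1 ≤ val p × val p ≤ n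
  val-range {p} p<n = s≤s z≤n , s≤s (begin
    Q * (R ∸ residue p) + row p   ≤⟨ +-mono-≤ (*-monoʳ-≤ Q (m∸n≤m R (residue p))) (≤-pred (row<1+Q p<n)) ⟩
    Q * R + Q                     ≡⟨ +-comm (Q * R) Q ⟩
    Q + Q * R                     ≡⟨ cong (Q +_) (*-comm Q R) ⟩
    r * Q                         ∎)
    where open ≤-Reasoning

  val-ascent : ∀ {p p′} → p < p′ → residue p′ ≤ residue p → val p < val p′
  val-ascent p<p′ res≤ = s<s (+-mono-≤-< (*-monoʳ-≤ Q (∸-monoʳ-≤ R res≤))
                                         (m<n⇒n%o≤m%o⇒m/o<n/o r (+-monoˡ-< R p<p′) res≤))

  val-descent : ∀ {p p′} → p′ < n → residue p < residue p′ → val p′ < val p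
  val-descent {p} {p′} p′<n res< = s<s (begin-strict
    Q * (R ∸ residue p′) + row p′   ≤⟨ +-monoʳ-≤ (Q * (R ∸ residue p′)) (≤-pred (row<1+Q p′<n)) ⟩
    Q * (R ∸ residue p′) + Q        ≡⟨ trans (+-comm _ Q) (sym (*-suc Q (R ∸ residue p′))) ⟩
    Q * suc (R ∸ residue p′)        ≤⟨ *-monoʳ-≤ Q (∸-monoʳ-< res< (residue≤R p′)) ⟩
    Q * (R ∸ residue p)             <⟨ m<m+n (Q * (R ∸ residue p)) (row>0 p res<) ⟩
    Q * (R ∸ residue p) + row p     ∎)
    where
    open ≤-Reasoning
    -- Position 0 is the only one in row 0, and its residue R is maximal.
    row>0 : ∀ p → residue p < residue p′ → 0 < row p
    row>0 zero    res< = contradiction (≤-trans res< (residue≤R p′))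
                                       (≤⇒≯ (≤-reflexive (sym (m<n⇒m%n≡m (n<1+n R)))))
    row>0 (suc p) _    = m≥n⇒m/n>0 (s≤s (m≤n+m R p))

  val-≢ : ∀ {p p′} → p < p′ → p′ < n → val p ≢ val p′
  val-≢ {p} {p′} p<p′ p′<n with residue p <? residue p′
  ... | yes res< = ≢-sym (<⇒≢ (val-descent {p} p′<n res<))
  ... | no  res≮ = <⇒≢ (val-ascent p<p′ (≮⇒≥ res≮))

  val-injective : ∀ {p p′} → p < n → p′ < n → val p ≡ val p′ → p ≡ p′
  val-injective {p} {p′} p<n p′<n eq with <-cmp p p′
  ... | tri< p<p′ _ _ = contradiction eq (val-≢ p<p′ p′<n)
  ... | tri≈ _ p≡p′ _ = p≡p′
  ... | tri> _ _ p′<p = contradiction (sym eq) (val-≢ p′<p p<n)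

  open CyclicSequence n φ val φ≡val val-range

  shift-close : ∀ {p p′} → p′ ≤ p + r → p′ + R ≤ p + R + r
  shift-close {p} {p′} p′≤p+r = ≤-trans (+-monoˡ-≤ R p′≤p+r) (≤-reflexive (begin
    p + r + R     ≡⟨ +-assoc p r R ⟩
    p + (r + R)   ≡⟨ cong (p +_) (+-comm r R) ⟩
    p + (R + r)   ≡⟨ +-assoc p R r ⟨
    p + R + r     ∎))
    where open ≡-Reasoning

  row-mono : ∀ {p p′} → p ≤ p′ → row p ≤ row p′
  row-mono p≤p′ = /-monoˡ-≤ r (+-monoˡ-≤ R p≤p′)

  row-close : ∀ {p p′} → p′ ≤ p + r → row p′ ≤ suc (row p)
  row-close {p} p′≤p+r = ≤-trans (/-monoˡ-≤ r (shift-close p′≤p+r)) (≤-reflexive ([m+n]/n≡1+m/n (p + R) r))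

  ascent⇒row-< : ∀ {p p′} → p < p′ → p′ < n → val p < val p′ → row p < row p′
  ascent⇒row-< {p} {p′} p<p′ p′<n asc with residue p <? residue p′
  ... | yes res< = contradiction asc (<⇒≯ (val-descent {p} p′<n res<))
  ... | no  res≮ = m<n⇒n%o≤m%o⇒m/o<n/o r (+-monoˡ-< R p<p′) (≮⇒≥ res≮)

  descent⇒row-≤ : ∀ {p p′} → p < p′ → p′ ≤ p + r → val p′ < val p → row p′ ≤ row p
  descent⇒row-≤ {p} {p′} p<p′ p′≤p+r desc with row p <? row p′
  ... | yes row< = contradiction desc
                     (<⇒≯ (val-ascent p<p′ (n≤m+o⇒m/o<n/o⇒n%o≤m%o r (shift-close p′≤p+r) row<)))
  ... | no  row≮ = ≮⇒≥ row≮

  SameBlock : ℕ → ℕ → Set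
  SameBlock p p′ = p / suc r ≡ p′ / suc r

  same-block-close : ∀ {p p′} → p ≤ p′ → SameBlock p p′ → p′ ≤ p + r
  same-block-close {p} {p′} p≤p′ eq = ≤-pred (subst (p′ <_) (+-suc p r) (m≤n⇒m/o≡n/o⇒n<m+o (suc r) p≤p′ eq))

  block-acyclic : ∀ {u v w} → v < n → w < n → SameBlock u v → SameBlock v w → ¬ CyclicAscending u v w
  block-acyclic v<n w<n uv vw (inj₁ (u<v , v<w) , asc₁ , asc₂) =
    <⇒≱ (≤-trans (s≤s (ascent⇒row-< u<v v<n asc₁)) (ascent⇒row-< v<w w<n asc₂))
        (row-close (same-block-close (<⇒≤ (<-trans u<v v<w)) (trans uv vw)))
  block-acyclic v<n w<n uv vw (inj₂ (inj₁ (v<w , w<u)) , asc₁ , asc₂) =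
    <⇒≱ (ascent⇒row-< v<w w<n asc₂)
        (≤-trans (row-mono (<⇒≤ w<u))
                 (descent⇒row-≤ v<u (same-block-close (<⇒≤ v<u) (sym uv)) asc₁))
    where v<u = <-trans v<w w<u
  block-acyclic v<n w<n uv vw (inj₂ (inj₂ (w<u , u<v)) , asc₁ , asc₂) =
    <⇒≱ (ascent⇒row-< u<v v<n asc₁)
        (≤-trans (descent⇒row-≤ w<v (same-block-close (<⇒≤ w<v) (sym vw)) asc₂)
                 (row-mono (<⇒≤ w<u)))
    where w<v = <-trans w<u u<v

  equal-residues⇒cyclicAscending : ∀ {q p p′} → q < p → p < p′ → p′ < n → residue p ≡ residue p′ →
                                   CyclicAscending q p p′ ⊎ CyclicAscending p p′ q
  equal-residues⇒cyclicAscending {q} {p} q<p p<p′ p′<n res≡ with residue q <? residue p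
  ... | yes res< = inj₂ (inj₂ (inj₂ (q<p , p<p′)) , val-ascent p<p′ (≤-reflexive (sym res≡)) ,
                         val-descent {q} p′<n (subst (residue q <_) res≡ res<))
  ... | no  res≮ = inj₁ (inj₁ (q<p , p<p′) , val-ascent q<p (≮⇒≥ res≮) ,
                         val-ascent p<p′ (≤-reflexive (sym res≡)))

  M : ℕ
  M = ceilDiv n (suc r)

  position : ℕ → Fin n
  position = preimage (val ∘ toℕ)

  colour : ℕ → Fin M
  colour v = fromℕ< (m<n⇒m/o<ceilDiv (suc r) (toℕ<n (position v)))

  toℕ-colour-val : ∀ {p} → p < n → toℕ (colour (val p)) ≡ p / suc r
  toℕ-colour-val {p} p<n = begin
    toℕ (colour (val p))                  ≡⟨ toℕ-fromℕ< _ ⟩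
    toℕ (position (val p)) / suc r        ≡⟨ cong (λ t → toℕ (position (val t)) / suc r) (toℕ-fromℕ< p<n) ⟨
    toℕ (position (val (toℕ i))) / suc r  ≡⟨ cong (λ j → toℕ j / suc r) (preimage-inverse val∘toℕ-injective i) ⟩
    toℕ i / suc r                         ≡⟨ cong (_/ suc r) (toℕ-fromℕ< p<n) ⟩
    p / suc r                             ∎
    where
    open ≡-Reasoning
    i = fromℕ< p<n
    val∘toℕ-injective : Injective _≡_ _≡_ (val ∘ toℕ)
    val∘toℕ-injective {j} {k} eq = toℕ-injective (val-injective (toℕ<n j) (toℕ<n k) eq)

  colour-proper : ProperColouring n φ M colour
  colour-proper = noMonochromaticTriple⇒proper λ u<n v<n w<n asc (e₁ , e₂) →
    block-acyclic v<n w<n (same-block u<n v<n e₁) (same-block v<n w<n e₂) asc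
    where
    same-block : ∀ {p p′} → p < n → p′ < n → colour (val p) ≡ colour (val p′) → SameBlock p p′
    same-block p<n p′<n eq = trans (sym (toℕ-colour-val p<n)) (trans (cong toℕ eq) (toℕ-colour-val p′<n))

  module _ {m} {col : ℕ → Fin m} (proper : ProperColouring n φ m col) where

    residues-distinct : ∀ {q p p′} → q < p → p < p′ → p′ < n →
                        col (val q) ≡ col (val p) → col (val p) ≡ col (val p′) → residue p ≢ residue p′
    residues-distinct q<p p<p′ p′<n e₁ e₂ res≡ =
      [ (λ asc → none q<n p<n p′<n asc (e₁ , e₂)) ,
        (λ asc → none p<n p′<n q<n asc (e₂ , sym (trans e₁ e₂))) ]′
        (equal-residues⇒cyclicAscending q<p p<p′ p′<n res≡)
      where
      none = proper⇒noMonochromaticTriple proper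
      p<n = <-trans p<p′ p′<n
      q<n = <-trans q<p p<n

    private
      class : Fin n → Fin m
      class i = col (val (toℕ i))

      earlier? : ∀ i → Dec (∃[ j ] toℕ j < toℕ i × class j ≡ class i)
      earlier? i = any? (λ j → toℕ j <? toℕ i ×-dec class j Fin.≟ class i)

      key : Fin n → Fin (suc r)
      key i with earlier? i
      ... | yes _ = suc ((toℕ i + R) mod r)
      ... | no  _ = zero

      key-separates : ∀ {i i′} → toℕ i < toℕ i′ → class i ≡ class i′ → key i ≢ key i′
      key-separates {i} {i′} i<i′ eq with earlier? i | earlier? i′
      ... | _                  | no ∄j = λ _ → ∄j (i , i<i′ , eq)
      ... | no _               | yes _ = λ ()
      ... | yes (j , j<i , ej) | yes _ = λ keq →
        residues-distinct j<i i<i′ (toℕ<n i′) ej eq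
          (trans (sym (toℕ-fromℕ< _)) (trans (cong toℕ (Fin.suc-injective keq)) (toℕ-fromℕ< _)))

    n≤m*[1+r] : n ≤ m * suc r
    n≤m*[1+r] = injective⇒≤ {f = λ i → combine (class i) (key i)} injective
      where
      injective : ∀ {i i′} → combine (class i) (key i) ≡ combine (class i′) (key i′) → i ≡ i′
      injective {i} {i′} eq with combine-injective (class i) (key i) (class i′) (key i′) eq | Fin.<-cmp i i′
      ... | class≡ , key≡ | tri< i<i′ _ _ = contradiction key≡ (key-separates i<i′ class≡)
      ... | _             | tri≈ _ i≡i′ _ = i≡i′
      ... | class≡ , key≡ | tri> _ _ i′<i = contradiction (sym key≡) (key-separates i′<i (sym class≡))

lemma4 : (q r : ℕ) → .{{_ : NonZero q}} → .{{_ : NonZero r}} →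
           ChromaticNumberIs (wn q r) (phiW q r) (ceilDiv (wn q r) (suc r))
lemma4 (suc Q) (suc R) =
  (colour , colour-proper) , λ _ (_ , proper) → ceilDiv-least (suc (suc R)) (n≤m*[1+r] proper)
  where open Winding Q R
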